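{- Let $G$ be a finite connected 2-edge-connected graph and let $S\subset E(G)$. The spanning subgraph $H=G-S$ is a maximal proper strongly orientable subgraph of $G$ if and only if $S$ is a 2-cut block of $G$.
   Context: Graphs may have loops and multiple edges. Subgraphs are spanning subgraphs determined by a subset of edges; $G-S$ has the edges $E(G)\setminus S$. $G$ is 2-edge-connected if deleting any one edge leaves it connected. A 2-cut is a pair $\{e,f\}$ of distinct edges with $G-\{e,f\}$ disconnected. The relation "$e=f$ or $\{e,f\}$ is a 2-cut" is an equivalence relation on $E(G)$; its equivalence classes are called 2-cut blocks. A subgraph is strongly orientable if it has an orientation in which every connected component is strongly connected; equivalently, every connected component is 2-edge-connected. A proper subgraph is one with $S\neq\emptyset$. -}

module Defs where

open import Data.Nat using (ℕ)
open import Data.Fin using (Fin)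
open import Data.Fin.Subset using (Subset; _∈_; _∉_; _⊂_; ∁; ⁅_⁆; _∪_; Nonempty)
open import Data.Product using (_×_; _,_; proj₁; proj₂; ∃)
open import Data.Sum using (_⊎_)
open import Data.Bool using (Bool; true; false)
open import Relation.Binary.PropositionalEquality using (_≡_; _≢_)
open import Relation.Nullary using (¬_)

-- A finite multigraph (loops and parallel edges allowed):
-- vertices Fin n, edges Fin m, each edge has an (unordered) pair of ends.
record Graph : Set where
  field
    n   : ℕ
    m   : ℕ
    ends : Fin m → Fin n × Fin n

module _ (G : Graph) where
  open Graph G

  -- Edge sets of spanning subgraphs are subsets of Fin m.
  EdgeSet : Set
  EdgeSet = Subset m

  data Reach (A : EdgeSet) : Fin n → Fin n → Set where
    here : ∀ {u} → Reach A u u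
    step : ∀ {u w v} (e : Fin m) → e ∈ A →
           (ends e ≡ (u , w) ⊎ ends e ≡ (w , u)) →
           Reach A w v → Reach A u v

  -- An orientation: o e = true orients e from proj₁ (ends e) to proj₂ (ends e),
  -- o e = false orients it the other way.
  Orientation : Set
  Orientation = Fin m → Bool

  tail head : Orientation → Fin m → Fin n
  tail o e with o e
  ... | true  = proj₁ (ends e)
  ... | false = proj₂ (ends e)
  head o e with o e
  ... | true  = proj₂ (ends e)
  ... | false = proj₁ (ends e)

  data DReach (A : EdgeSet) (o : Orientation) : Fin n → Fin n → Set where
    here : ∀ {u} → DReach A o u u
    step : ∀ {v} (e : Fin m) → e ∈ A →
           DReach A o (head o e) v → DReach A o (tail o e) v

  ConnectedSub : EdgeSet → Set
  ConnectedSub A = ∀ u v → Reach A u v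

  Connected : Set
  Connected = ∀ u v → Reach (∁ (Data.Fin.Subset.⊥)) u v

  TwoEdgeConnected : Set
  TwoEdgeConnected = ∀ e → ConnectedSub (∁ ⁅ e ⁆)

  TwoCut : Fin m → Fin m → Set
  TwoCut e f = e ≢ f × ¬ ConnectedSub (∁ (⁅ e ⁆ ∪ ⁅ f ⁆))

  -- S is a 2-cut block: an equivalence class of the relation
  -- "e = f or {e,f} is a 2-cut".
  IsTwoCutBlock : Subset m → Set
  IsTwoCutBlock S = ∃ λ e → e ∈ S × (∀ f → (f ∈ S → (e ≡ f ⊎ TwoCut e f)) × ((e ≡ f ⊎ TwoCut e f) → f ∈ S))

  -- The spanning subgraph with edge set A is strongly orientable: there is an
  -- orientation in which every connected component is strongly connected.
  StronglyOrientable : EdgeSet → Set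
  StronglyOrientable A = ∃ λ (o : Orientation) → ∀ u v → Reach A u v → DReach A o u v

  -- G - S is a maximal proper strongly orientable subgraph of G:
  -- S ≠ ∅, G - S strongly orientable, and no strongly orientable proper
  -- subgraph G - S' strictly contains G - S (i.e. no nonempty S' ⊂ S).
  IsMaxProperSO : Subset m → Set
  IsMaxProperSO S = Nonempty S × StronglyOrientable (∁ S) ×
    (∀ (S' : Subset m) → S' ⊂ S → Nonempty S' → ¬ StronglyOrientable (∁ S'))

module Submission where

-- The graph-specific facts, for G 2-edge-connected, are:
--  * {e,f} is a 2-cut iff f is a bridge of G - e, and the 2-cut relation is
--    transitive, so distinct edges of one block form a 2-cut;
--  * the edges outside a block form a bridgeless, hence strongly orientable,
--    subgraph;
--  * if G - S is strongly orientable, no 2-cut has one edge in S and one outside.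
-- Both directions of the lemma follow directly.

open import Defs
open import Data.Fin using (Fin; _≟_)
open import Data.Product using (Σ; _×_; _,_; proj₁; proj₂)
open import Data.Product.Properties using (,-injectiveˡ; ,-injectiveʳ)
open import Data.Sum using (_⊎_; inj₁; inj₂; [_,_])
open import Data.Empty using (⊥; ⊥-elim)
open import Data.Bool using (Bool; true; false)
open import Data.List using (List; []; _∷_; allFin)
open import Data.List.Relation.Unary.Any using (here; there)
open import Data.List.Membership.Propositional.Properties using (∈-allFin)
open import Data.Fin.Properties using (all?)
open import Relation.Nullary using (¬_; Dec; yes; no)
open import Relation.Nullary.Decidable using (_×-dec_; _⊎-dec_; ¬?; map′; isYes; toWitness; fromWitness)
open import Data.Fin.Subset using (Subset; _∈_; _∉_; _⊂_; ∁; ⁅_⁆; _∪_; Nonempty)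
open import Data.Fin.Subset.Properties using (x∈∁p⇒x∉p; x∉p⇒x∈∁p; x∈p∪q⁺; x∈p∪q⁻; x∈⁅x⁆; x∈⁅y⁆⇒x≡y; _∈?_)
open import Data.Unit using (⊤; tt)
open import Data.Vec using (tabulate)
open import Data.Vec.Properties using (lookup∘tabulate; []=⇒lookup; lookup⇒[]=)
open import Data.Bool.Properties using (T-≡)
open import Function.Bundles using (Equivalence)
open import Relation.Binary.PropositionalEquality using (_≡_; _≢_; refl; sym; trans; subst₂)
import Data.List.Membership.Propositional as List

-- The subset of Fin k cut out by a decidable predicate, and its membership.
-- (Needed to turn the block of an edge into an edge set.)
subset-of : ∀ {k} {P : Fin k → Set} → (∀ i → Dec (P i)) → Subset k
subset-of P? = tabulate (λ i → isYes (P? i))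

∈-subset-of⁻ : ∀ {k} {P : Fin k → Set} (P? : ∀ i → Dec (P i)) {i} → i ∈ subset-of P? → P i
∈-subset-of⁻ P? {i} i∈ =
  toWitness (Equivalence.from T-≡ (trans (sym (lookup∘tabulate _ i)) ([]=⇒lookup i∈)))

∈-subset-of⁺ : ∀ {k} {P : Fin k → Set} (P? : ∀ i → Dec (P i)) {i} → P i → i ∈ subset-of P?
∈-subset-of⁺ P? {i} pi =
  lookup⇒[]= i _ (trans (lookup∘tabulate _ i) (Equivalence.to T-≡ (fromWitness pi)))

module Theory (G : Graph) where
  open Graph G

  Vertex Edge : Set
  Vertex = Fin n
  Edge   = Fin m

  -- Spanning subgraphs are described by (not necessarily decidable)
  -- predicates on edges; P - f removes the edge f.
  EdgePred : Set₁
  EdgePred = Edge → Set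

  _-_ : EdgePred → Edge → EdgePred
  (P - f) g = P g × g ≢ f

  end₁ end₂ : Edge → Vertex
  end₁ f = proj₁ (ends f)
  end₂ f = proj₂ (ends f)

  Adj : Edge → Vertex → Vertex → Set
  Adj e u w = ends e ≡ (u , w) ⊎ ends e ≡ (w , u)

  adj-sym : ∀ {e u w} → Adj e u w → Adj e w u
  adj-sym (inj₁ eq) = inj₂ eq
  adj-sym (inj₂ eq) = inj₁ eq

  -- Walks whose steps are drawn from an arbitrary step relation; undirected
  -- walks, directed walks and "mixed" walks are all instances.
  data Walk (Step : Edge → Vertex → Vertex → Set) : Vertex → Vertex → Set where
    here : ∀ {u} → Walk Step u u
    step : ∀ {u w v} e → Step e u w → Walk Step w v → Walk Step u v

  module _ {Step : Edge → Vertex → Vertex → Set} where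
    _++_ : ∀ {u w v} → Walk Step u w → Walk Step w v → Walk Step u v
    here       ++ q = q
    step e s p ++ q = step e s (p ++ q)

    single : ∀ {e u w} → Step e u w → Walk Step u w
    single {e} s = step e s here

  module _ {Step : Edge → Vertex → Vertex → Set} where
    walk-bind : ∀ {Step' u v} → (∀ {g a b} → Step g a b → Walk Step' a b) →
                Walk Step u v → Walk Step' u v
    walk-bind f here         = here
    walk-bind f (step e s p) = f s ++ walk-bind f p

    walk-map : ∀ {Step' u v} → (∀ {g a b} → Step g a b → Step' g a b) →
               Walk Step u v → Walk Step' u v
    walk-map f here         = here
    walk-map f (step e s p) = step e (f s) (walk-map f p)

  Along : EdgePred → Edge → Vertex → Vertex → Set
  Along P e u w = P e × Adj e u w

  UWalk : EdgePred → Vertex → Vertex → Set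
  UWalk P = Walk (Along P)

  uwalk-mono : ∀ {P Q u v} → (∀ g → P g → Q g) → UWalk P u v → UWalk Q u v
  uwalk-mono P⊆Q = walk-map (λ { {g} (p , a) → P⊆Q g p , a })

  reverse : ∀ {P u v} → UWalk P u v → UWalk P v u
  reverse here               = here
  reverse (step e (p , a) q) = reverse q ++ single (p , adj-sym a)

  Conn : EdgePred → Set
  Conn P = ∀ u v → UWalk P u v

  -- Adj in a form that can be matched on: matching instantiates the
  -- vertices to the ends of the edge.
  data Ends (g : Edge) : Vertex → Vertex → Set where
    forward  : Ends g (end₁ g) (end₂ g)
    backward : Ends g (end₂ g) (end₁ g)

  adj⇒ends : ∀ {g u w} → Adj g u w → Ends g u w
  adj⇒ends {g} (inj₁ eq) = subst₂ (Ends g) (,-injectiveˡ eq) (,-injectiveʳ eq) forward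
  adj⇒ends {g} (inj₂ eq) = subst₂ (Ends g) (,-injectiveʳ eq) (,-injectiveˡ eq) backward

  across : ∀ {R g u w} → Adj g u w → UWalk R w u → UWalk R (end₁ g) (end₂ g)
  across a p with adj⇒ends a
  ... | forward  = reverse p
  ... | backward = p

  NonBridge : EdgePred → Edge → Set
  NonBridge P f = UWalk (P - f) (end₁ f) (end₂ f)

  Bridgeless : EdgePred → Set
  Bridgeless P = ∀ f → P f → NonBridge P f

  bridgeless-cong : ∀ {P Q} → (∀ g → P g → Q g) → (∀ g → Q g → P g) → Bridgeless P → Bridgeless Q
  bridgeless-cong P⊆Q Q⊆P bridgeless f qf =
    uwalk-mono (λ g (pg , g≢f) → P⊆Q g pg , g≢f) (bridgeless f (Q⊆P f qf))

  reroute : ∀ {P u v} f → NonBridge P f → UWalk P u v → UWalk (P - f) u v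
  reroute {P} f nb = walk-bind avoid-f
    where
    avoid-f : ∀ {g a b} → Along P g a b → UWalk (P - f) a b
    avoid-f {g} (p , a) with g ≟ f
    ... | no g≢f = single ((p , g≢f) , a)
    ... | yes refl with adj⇒ends a
    ...   | forward  = nb
    ...   | backward = reverse nb

  conn-minus-nonbridge : ∀ {P} f → Conn P → NonBridge P f → Conn (P - f)
  conn-minus-nonbridge f c nb u v = reroute f nb (c u v)

  Detour : EdgePred → Edge → Vertex → Vertex → Set
  Detour P f u v = UWalk (P - f) u v
                 ⊎ (UWalk (P - f) u (end₁ f) × UWalk (P - f) (end₂ f) v)
                 ⊎ (UWalk (P - f) u (end₂ f) × UWalk (P - f) (end₁ f) v)

  detour : ∀ {P u v} f → UWalk P u v → Detour P f u v
  detour f here = inj₁ here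
  detour f (step g (p , a) rest) with g ≟ f
  ... | no g≢f = extend (step g ((p , g≢f) , a)) (detour f rest)
    where
    extend : ∀ {P u w v} → (∀ {x} → UWalk (P - f) w x → UWalk (P - f) u x) →
             Detour P f w v → Detour P f u v
    extend pre (inj₁ r)               = inj₁ (pre r)
    extend pre (inj₂ (inj₁ (r , r'))) = inj₂ (inj₁ (pre r , r'))
    extend pre (inj₂ (inj₂ (r , r'))) = inj₂ (inj₂ (pre r , r'))
  ... | yes refl = enter (adj⇒ends a) (detour f rest)
    where
    enter : ∀ {P u w v} → Ends f u w → Detour P f w v → Detour P f u v
    enter forward  (inj₁ r)              = inj₂ (inj₁ (here , r))
    enter forward  (inj₂ (inj₁ (_ , r))) = inj₂ (inj₁ (here , r))
    enter forward  (inj₂ (inj₂ (_ , r))) = inj₁ r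
    enter backward (inj₁ r)              = inj₂ (inj₂ (here , r))
    enter backward (inj₂ (inj₁ (_ , r))) = inj₁ r
    enter backward (inj₂ (inj₂ (_ , r))) = inj₂ (inj₂ (here , r))

  dec-walk-step : ∀ {Q R} f → Dec (Q f) → (∀ g → (Q - f) g → R g) → (∀ g → R g → Q g) →
                  (∀ u v → Dec (UWalk R u v)) → ∀ u v → Dec (UWalk Q u v)
  dec-walk-step f (no ¬qf) shrink grow dec u v =
    map′ (uwalk-mono grow) (uwalk-mono (λ g q → shrink g (q , λ { refl → ¬qf q }))) (dec u v)
  dec-walk-step {Q} f (yes qf) shrink grow dec u v
    with dec u v ⊎-dec (dec u (end₁ f) ×-dec dec (end₂ f) v)
                 ⊎-dec (dec u (end₂ f) ×-dec dec (end₁ f) v)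
  ... | yes (inj₁ p)              = yes (uwalk-mono grow p)
  ... | yes (inj₂ (inj₁ (p , q))) = yes (uwalk-mono grow p ++ step f (qf , inj₁ refl) (uwalk-mono grow q))
  ... | yes (inj₂ (inj₂ (p , q))) = yes (uwalk-mono grow p ++ step f (qf , inj₂ refl) (uwalk-mono grow q))
  ... | no none = no (λ p → none (to-R (detour f p)))
    where
    to-R : Detour Q f u v → _
    to-R (inj₁ p)              = inj₁ (uwalk-mono shrink p)
    to-R (inj₂ (inj₁ (p , q))) = inj₂ (inj₁ (uwalk-mono shrink p , uwalk-mono shrink q))
    to-R (inj₂ (inj₂ (p , q))) = inj₂ (inj₂ (uwalk-mono shrink p , uwalk-mono shrink q))

  InList : EdgePred → List Edge → EdgePred
  InList P L g = P g × g List.∈ L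

  dec-walk-list : ∀ {P} → (∀ g → Dec (P g)) → ∀ L u v → Dec (UWalk (InList P L) u v)
  dec-walk-list P? [] u v with u ≟ v
  ... | yes refl = yes here
  ... | no u≢v   = no (no-walk u≢v)
    where
    no-walk : ∀ {u v} → u ≢ v → ¬ UWalk (InList _ []) u v
    no-walk u≢v here                    = u≢v refl
    no-walk u≢v (step e ((_ , ()) , _) _)
  dec-walk-list {P} P? (f ∷ L) =
    dec-walk-step f (P? f ×-dec yes (here refl)) shrink grow (dec-walk-list P? L)
    where
    shrink : ∀ g → (InList P (f ∷ L) - f) g → InList P L g
    shrink g ((p , here refl) , g≢f) = ⊥-elim (g≢f refl)
    shrink g ((p , there i)   , _)   = p , i
    grow : ∀ g → InList P L g → InList P (f ∷ L) g
    grow g (p , i) = p , there i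

  dec-walk : ∀ {P} → (∀ g → Dec (P g)) → ∀ u v → Dec (UWalk P u v)
  dec-walk P? u v = map′ (uwalk-mono (λ g → proj₁)) (uwalk-mono (λ g p → p , ∈-allFin g))
                         (dec-walk-list P? (allFin m) u v)

  dec-conn : ∀ {P} → (∀ g → Dec (P g)) → Dec (Conn P)
  dec-conn P? = all? (λ u → all? (λ v → dec-walk P? u v))

  -- Trails: walks using each edge at most once (each step removes its edge
  -- from the available edges).
  data Trail : EdgePred → Vertex → Vertex → Set₁ where
    here : ∀ {P u} → Trail P u u
    step : ∀ {P u w v} e → P e → Adj e u w → Trail (P - e) w v → Trail P u v

  trail-mono : ∀ {P Q u v} → (∀ g → P g → Q g) → Trail P u v → Trail Q u v
  trail-mono P⊆Q here           = here
  trail-mono P⊆Q (step e p a t) =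
    step e (P⊆Q e p) a (trail-mono (λ g (pg , g≢e) → P⊆Q g pg , g≢e) t)

  trail-walk : ∀ {P u v} → Trail P u v → UWalk P u v
  trail-walk here           = here
  trail-walk (step e p a t) = step e (p , a) (uwalk-mono (λ g → proj₁) (trail-walk t))

  Visits : ∀ {P u v} → Vertex → Trail P u v → Set
  Visits {u = u} x here           = x ≡ u
  Visits {u = u} x (step e p a t) = x ≡ u ⊎ Visits x t

  visits? : ∀ {P u v} x (t : Trail P u v) → Dec (Visits x t)
  visits? {u = u} x here           = x ≟ u
  visits? {u = u} x (step e p a t) = (x ≟ u) ⊎-dec visits? x t

  visits-start : ∀ {P u v} (t : Trail P u v) → Visits u t
  visits-start here           = refl
  visits-start (step e p a t) = inj₁ refl

  suffix : ∀ {P u v x} (t : Trail P u v) → Visits x t → Trail P x v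
  suffix here           refl        = here
  suffix (step e p a t) (inj₁ refl) = step e p a t
  suffix (step e p a t) (inj₂ x∈t)  = trail-mono (λ g → proj₁) (suffix t x∈t)

  EndOf : Edge → Vertex → Set
  EndOf f x = x ≡ end₁ f ⊎ x ≡ end₂ f

  adj-end : ∀ {g u w} → Adj g u w → EndOf g u
  adj-end a with adj⇒ends a
  ... | forward  = inj₁ refl
  ... | backward = inj₂ refl

  avoid : ∀ {P u v x} f (t : Trail P u v) → ¬ Visits x t → EndOf f x → Trail (P - f) u v
  avoid f here nv x-end = here
  avoid {x = x} f (step g p a t) nv x-end with g ≟ f
  ... | no g≢f = step g (p , g≢f) a
                   (trail-mono (λ h ((ph , h≢f) , h≢g) → (ph , h≢g) , h≢f)
                               (avoid f t (λ x∈t → nv (inj₂ x∈t)) x-end))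
  ... | yes refl = ⊥-elim (nv (visited (adj⇒ends a) x-end))
    where
    visited : ∀ {u w} {t : Trail (_ - g) w _} → Ends g u w → EndOf g x → x ≡ u ⊎ Visits x t
    visited {t = t} forward  (inj₁ refl) = inj₁ refl
    visited {t = t} forward  (inj₂ refl) = inj₂ (visits-start t)
    visited {t = t} backward (inj₁ refl) = inj₂ (visits-start t)
    visited {t = t} backward (inj₂ refl) = inj₁ refl

  -- Every walk can be shortened to a trail (by cutting out closed subwalks).
  trailify : ∀ {P u v} → UWalk P u v → Trail P u v
  trailify here = here
  trailify {u = u} (step g (p , a) rest) with trailify rest
  ... | t with visits? u t
  ...   | yes u∈t = suffix t u∈t
  ...   | no  u∉t = step g p a (avoid g t u∉t (adj-end a))

  trail-nonbridges : ∀ {P Q u v} → Trail P u v → (∀ h → P h → Q h) →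
                     (∀ h → P h → UWalk (Q - h) v u) →
                     UWalk (λ h → P h × NonBridge Q h) u v
  trail-nonbridges here P⊆Q close = here
  trail-nonbridges {P} {Q} (step g pg a t) P⊆Q close =
    step g ((pg , across a (uwalk-mono drop (trail-walk t) ++ close g pg)) , a)
      (uwalk-mono (λ h ((ph , _) , nb) → ph , nb)
        (trail-nonbridges t (λ h ph → P⊆Q h (proj₁ ph))
          (λ h (ph , h≢g) → close h ph ++ single ((P⊆Q g pg , λ g≡h → h≢g (sym g≡h)) , a))))
    where
    drop : ∀ h → (P - g) h → (Q - g) h
    drop h (ph , h≢g) = P⊆Q h ph , h≢g

  -- o orients e from u to w (a record, so that o can be inferred from an Arc).
  record Arc (o : Orientation G) (e : Edge) (u w : Vertex) : Set where
    constructor _,_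
    field
      tail≡ : tail G o e ≡ u
      head≡ : head G o e ≡ w

  tail-cong : ∀ {o o' e} → o e ≡ o' e → tail G o e ≡ tail G o' e
  tail-cong {o} {o'} {e} eq with o e | o' e | eq
  ... | b | .b | refl = refl

  head-cong : ∀ {o o' e} → o e ≡ o' e → head G o e ≡ head G o' e
  head-cong {o} {o'} {e} eq with o e | o' e | eq
  ... | b | .b | refl = refl

  arc-cong : ∀ {o o' e u w} → o e ≡ o' e → Arc o e u w → Arc o' e u w
  arc-cong {o} {o'} {e} eq (t , h) =
    trans (sym (tail-cong {o} {o'} {e} eq)) t , trans (sym (head-cong {o} {o'} {e} eq)) h

  arc-adj : ∀ {o e u w} → Arc o e u w → Adj e u w
  arc-adj {o} {e} (refl , refl) with o e
  ... | true  = inj₁ refl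
  ... | false = inj₂ refl

  arc-forward : ∀ {o e} → o e ≡ true → Arc o e (end₁ e) (end₂ e)
  arc-forward {o} {e} eq = tail-end , head-end
    where
    tail-end : tail G o e ≡ end₁ e
    tail-end rewrite eq = refl
    head-end : head G o e ≡ end₂ e
    head-end rewrite eq = refl

  arc-backward : ∀ {o e} → o e ≡ false → Arc o e (end₂ e) (end₁ e)
  arc-backward {o} {e} eq = tail-end , head-end
    where
    tail-end : tail G o e ≡ end₂ e
    tail-end rewrite eq = refl
    head-end : head G o e ≡ end₁ e
    head-end rewrite eq = refl

  adj-arc : ∀ {o e u w} → Adj e u w → Arc o e u w ⊎ Arc o e w u
  adj-arc {o} {e} a with o e in eq | adj⇒ends a
  ... | true  | forward  = inj₁ (arc-forward eq)
  ... | true  | backward = inj₂ (arc-forward eq)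
  ... | false | forward  = inj₂ (arc-backward eq)
  ... | false | backward = inj₁ (arc-backward eq)

  direction : ∀ {g u w} → Ends g u w → Bool
  direction forward  = true
  direction backward = false

  arc-direction : ∀ {o g u w} (a : Ends g u w) → o g ≡ direction a → Arc o g u w
  arc-direction forward  eq = arc-forward eq
  arc-direction backward eq = arc-backward eq

  update : Edge → Bool → Orientation G → Orientation G
  update g b o h with h ≟ g
  ... | yes _ = b
  ... | no  _ = o h

  update-same : ∀ g b o → update g b o g ≡ b
  update-same g b o with g ≟ g
  ... | yes _    = refl
  ... | no  g≢g = ⊥-elim (g≢g refl)

  update-other : ∀ g b o h → h ≢ g → update g b o h ≡ o h
  update-other g b o h h≢g with h ≟ g
  ... | yes h≡g = ⊥-elim (h≢g h≡g)
  ... | no  _   = refl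

  Directed : EdgePred → Orientation G → Edge → Vertex → Vertex → Set
  Directed P o e u w = P e × Arc o e u w

  DWalk : EdgePred → Orientation G → Vertex → Vertex → Set
  DWalk P o = Walk (Directed P o)

  dwalk-mono : ∀ {P Q o u v} → (∀ g → P g → Q g) → DWalk P o u v → DWalk Q o u v
  dwalk-mono P⊆Q = walk-map (λ { {g} (p , arc) → P⊆Q g p , arc })

  dwalk-agree : ∀ {P o o' u v} → (∀ h → P h → o h ≡ o' h) → DWalk P o u v → DWalk P o' u v
  dwalk-agree agree = walk-map (λ { {g} (p , arc) → p , arc-cong (agree g p) arc })

  dwalk-undirected : ∀ {P o u v} → DWalk P o u v → UWalk P u v
  dwalk-undirected = walk-map (λ { (p , arc) → p , arc-adj arc })

  -- A directed walk ending at the tail of f can be cut to avoid f: cut it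
  -- at its first visit of that tail.
  dwalk-avoid-out : ∀ {P o w} f → DWalk P o w (tail G o f) → DWalk (P - f) o w (tail G o f)
  dwalk-avoid-out f here = here
  dwalk-avoid-out {P} {o} {w} f (step g (p , arc) rest) with w ≟ tail G o f
  ... | yes refl = here
  ... | no  w≢t  = step g ((p , λ { refl → w≢t (sym (Arc.tail≡ arc)) }) , arc)
                        (dwalk-avoid-out f rest)

  StronglyOriented : EdgePred → Orientation G → Set
  StronglyOriented P o = ∀ u v → UWalk P u v → DWalk P o u v

  -- A strongly orientable subgraph has no bridges: the directed walk back
  -- from the head of f to its tail can avoid f.
  strongly-oriented⇒bridgeless : ∀ {P o} → StronglyOriented P o → Bridgeless P
  strongly-oriented⇒bridgeless {P} {o} so f pf =
    across (arc-adj out) (dwalk-undirected (dwalk-avoid-out f back))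
    where
    out : Arc o f (tail G o f) (head G o f)
    out = refl , refl
    back : DWalk P o (head G o f) (tail G o f)
    back = so _ _ (single (pf , adj-sym (arc-adj out)))

  Closed : EdgePred → Orientation G → Set
  Closed D o = ∀ d → D d → DWalk D o (head G o d) (tail G o d)

  closed-agree : ∀ {D o o'} → (∀ h → D h → o h ≡ o' h) → Closed D o → Closed D o'
  closed-agree {D} {o} {o'} agree closed d dd =
    subst₂ (DWalk D o') (head-cong {o} {o'} {d} (agree d dd)) (tail-cong {o} {o'} {d} (agree d dd))
           (dwalk-agree agree (closed d dd))

  undirected-step : ∀ {D o g u w} → Closed D o → Along D g u w → DWalk D o u w
  undirected-step {D} {o} {g} closed (dg , a) with adj-arc {o} a
  ... | inj₁ arc          = single (dg , arc)
  ... | inj₂ (refl , refl) = closed g dg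

  closed⇒strongly-oriented : ∀ {D o} → Closed D o → StronglyOriented D o
  closed⇒strongly-oriented closed u v = walk-bind (undirected-step closed)

  Mixed : EdgePred → EdgePred → Orientation G → Edge → Vertex → Vertex → Set
  Mixed D Q r g u w = Q g × (Along D g u w ⊎ Arc r g u w)

  InWalk : ∀ {Step u v} → Edge → Walk Step u v → Set
  InWalk h here         = ⊥
  InWalk h (step g s p) = h ≡ g ⊎ InWalk h p

  inwalk? : ∀ {Step u v} h (p : Walk Step u v) → Dec (InWalk h p)
  inwalk? h here         = no (λ ())
  inwalk? h (step g s p) = (h ≟ g) ⊎-dec inwalk? h p

  record Split (Step : Edge → Vertex → Vertex → Set) (h : Edge) {u v} (p : Walk Step u v) : Set where
    constructor split-at
    field
      {a b} : Vertex
      before : Walk Step u a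
      along  : Step h a b
      after  : Walk Step b v
      before⊆ : ∀ k → InWalk k before → InWalk k p
      after⊆  : ∀ k → InWalk k after → InWalk k p

  split : ∀ {Step u v} h (p : Walk Step u v) → InWalk h p → Split Step h p
  split h (step g s p) (inj₁ refl) = split-at here s p (λ k ()) (λ k → inj₂)
  split h (step g s p) (inj₂ h∈p) with split h p h∈p
  ... | split-at p₁ s' p₂ p₁⊆ p₂⊆ =
    split-at (step g s p₁) s' p₂ (λ { k (inj₁ k≡g) → inj₁ k≡g ; k (inj₂ k∈p₁) → inj₂ (p₁⊆ k k∈p₁) })
             (λ k k∈p₂ → inj₂ (p₂⊆ k k∈p₂))

  module _ {D : EdgePred} {r : Orientation G} (closed : Closed D r) where
    mixed-step : ∀ {Q g u w} → Mixed D Q r g u w → DWalk (λ h → D h ⊎ h ≡ g) r u w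
    mixed-step (_ , inj₁ along) = dwalk-mono (λ _ → inj₁) (undirected-step closed along)
    mixed-step (_ , inj₂ arc)   = single (inj₂ refl , arc)

    mixed⇒directed : ∀ {Q u v} (p : Walk (Mixed D Q r) u v) → DWalk (λ h → D h ⊎ InWalk h p) r u v
    mixed⇒directed here = here
    mixed⇒directed {Q} (step g s p) =
      dwalk-mono (λ { h (inj₁ dh) → inj₁ dh ; h (inj₂ h≡g) → inj₂ (inj₁ h≡g) }) (mixed-step {Q} s)
      ++ dwalk-mono (λ { h (inj₁ dh) → inj₁ dh ; h (inj₂ h∈p) → inj₂ (inj₂ h∈p) }) (mixed⇒directed p)

    -- Closing a mixed walk into a cycle keeps closedness: each new edge
    -- returns along the rest of the cycle.
    closed-extend : ∀ {Q x} (c : Walk (Mixed D Q r) x x) → Closed (λ h → D h ⊎ InWalk h c) r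
    closed-extend c d (inj₁ dd) = dwalk-mono (λ _ → inj₁) (closed d dd)
    closed-extend {Q} c d (inj₂ d∈c) with split d c d∈c
    ... | split-at _ (_ , inj₁ (dd , _)) _ _ _ = dwalk-mono (λ _ → inj₁) (closed d dd)
    ... | split-at p₁ (_ , inj₂ (refl , refl)) p₂ p₁⊆ p₂⊆ =
      dwalk-mono (widen p₂⊆) (mixed⇒directed p₂) ++ dwalk-mono (widen p₁⊆) (mixed⇒directed p₁)
      where
      widen : ∀ {u v} {p : Walk (Mixed D Q r) u v} → (∀ k → InWalk k p → InWalk k c) →
              ∀ h → D h ⊎ InWalk h p → D h ⊎ InWalk h c
      widen p⊆c h (inj₁ dh)  = inj₁ dh
      widen p⊆c h (inj₂ h∈p) = inj₂ (p⊆c h h∈p)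

  -- Orienting a trail: the edges outside D are oriented along the trail,
  -- the orientation o of D is kept.
  record TrailOrientation (D : EdgePred) (o : Orientation G) (Q : EdgePred) (u v : Vertex) : Set where
    field
      orientation : Orientation G
      agrees      : ∀ h → D h → o h ≡ orientation h
      walk        : Walk (Mixed D Q orientation) u v

  module _ {D : EdgePred} (D? : ∀ g → Dec (D g)) (o : Orientation G) where
    orient-trail : ∀ {Q u v} → Trail Q u v → TrailOrientation D o Q u v
    orient-trail here = record { orientation = o ; agrees = λ _ _ → refl ; walk = here }
    orient-trail {Q} (step g q a t) with orient-trail t | D? g
    ... | record { orientation = r ; agrees = agrees ; walk = w } | yes dg = record
      { orientation = r
      ; agrees      = agrees
      ; walk        = step g (q , inj₁ (dg , a)) (walk-map (λ { ((q' , _) , s) → q' , s }) w)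
      }
    ... | record { orientation = r ; agrees = agrees ; walk = w } | no ¬dg = record
      { orientation = r'
      ; agrees      = λ h dh → trans (agrees h dh)
                                     (sym (update-other g _ r h (λ { refl → ¬dg dh })))
      ; walk        = step g (q , inj₂ (arc-direction way (update-same g _ r)))
                             (walk-map reoriented w)
      }
      where
      way : Ends g _ _
      way = adj⇒ends a
      r' : Orientation G
      r' = update g (direction way) r
      reoriented : ∀ {h x y} → Mixed D (Q - g) r h x y → Mixed D Q r' h x y
      reoriented ((q' , h≢g) , inj₁ along) = q' , inj₁ along
      reoriented {h} ((q' , h≢g) , inj₂ arc) =
        q' , inj₂ (arc-cong {r} {r'} {h} (sym (update-other g _ r h h≢g)) arc)

    first-edge-kept : ∀ {Q u w v g} (q : Q g) (a : Adj g u w) (t : Trail (Q - g) w v) →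
                      InWalk g (TrailOrientation.walk (orient-trail (step g q a t)))
    first-edge-kept {g = g} q a t with orient-trail t | D? g
    ... | _ | yes _ = inj₁ refl
    ... | _ | no  _ = inj₁ refl

  record Partial (P : EdgePred) : Set₁ where
    field
      D           : EdgePred
      D?          : ∀ g → Dec (D g)
      D⊆P         : ∀ g → D g → P g
      orientation : Orientation G
      closed      : Closed D orientation

  empty-partial : ∀ {P} → Partial P
  empty-partial = record
    { D = λ _ → ⊥ ; D? = λ _ → no (λ ()) ; D⊆P = λ _ ()
    ; orientation = λ _ → true ; closed = λ _ () }

  module _ {P : EdgePred} (bridgeless : Bridgeless P) where
    -- Ear addition: a non-bridge e closes a trail of P - e into a cycle;
    -- orienting that cycle enlarges the closed part by e and the cycle.
    add-ear : (s : Partial P) → ∀ {e} → P e →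
              Σ (Partial P) λ s' → (∀ g → Partial.D s g → Partial.D s' g) × Partial.D s' e
    add-ear s {e} pe = s' , (λ g → inj₁) , inj₂ (first-edge-kept D? orientation pe (inj₁ refl) back)
      where
      open Partial s
      back : Trail (P - e) (end₂ e) (end₁ e)
      back = trailify (reverse (bridgeless e pe))
      cycle : TrailOrientation D orientation P (end₁ e) (end₁ e)
      cycle = orient-trail D? orientation (step e pe (inj₁ refl) back)
      open TrailOrientation cycle renaming (orientation to r)
      in-cycle⊆P : ∀ h → InWalk h walk → P h
      in-cycle⊆P h h∈c = proj₁ (Split.along (split h walk h∈c))
      s' : Partial P
      s' = record
        { D           = λ h → D h ⊎ InWalk h walk
        ; D?          = λ h → D? h ⊎-dec inwalk? h walk
        ; D⊆P         = λ { h (inj₁ dh) → D⊆P h dh ; h (inj₂ h∈c) → in-cycle⊆P h h∈c }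
        ; orientation = r
        ; closed      = closed-extend (closed-agree agrees closed) walk
        }

    cover : (∀ g → Dec (P g)) → (L : List Edge) →
            Σ (Partial P) λ s → ∀ g → g List.∈ L → P g → Partial.D s g
    cover P? []      = empty-partial , λ g ()
    cover P? (f ∷ L) with cover P? L | P? f
    ... | s , covered | no ¬pf =
      s , λ { g (here refl) pg → ⊥-elim (¬pf pg) ; g (there g∈L) pg → covered g g∈L pg }
    ... | s , covered | yes pf with add-ear s pf
    ...   | s' , grows , f∈s' =
      s' , λ { g (here refl) pg → f∈s' ; g (there g∈L) pg → grows g (covered g g∈L pg) }

    robbins : (∀ g → Dec (P g)) → Σ (Orientation G) (StronglyOriented P)
    robbins P? with cover P? (allFin m)
    ... | s , covered = orientation , λ u v p →
      dwalk-mono D⊆P (closed⇒strongly-oriented closed u v (uwalk-mono (λ g → covered g (∈-allFin g)) p))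
      where open Partial s

  reach⇒uwalk : ∀ {A u v} → Reach G A u v → UWalk (_∈ A) u v
  reach⇒uwalk here           = here
  reach⇒uwalk (step e x a r) = step e (x , a) (reach⇒uwalk r)

  uwalk⇒reach : ∀ {A u v} → UWalk (_∈ A) u v → Reach G A u v
  uwalk⇒reach here               = here
  uwalk⇒reach (step e (x , a) r) = step e x a (uwalk⇒reach r)

  dreach⇒dwalk : ∀ {A o u v} → DReach G A o u v → DWalk (_∈ A) o u v
  dreach⇒dwalk here         = here
  dreach⇒dwalk (step e x r) = step e (x , (refl , refl)) (dreach⇒dwalk r)

  dwalk⇒dreach : ∀ {A o u v} → DWalk (_∈ A) o u v → DReach G A o u v
  dwalk⇒dreach here                           = here
  dwalk⇒dreach (step e (x , (refl , refl)) r) = step e x (dwalk⇒dreach r)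

  strongly-orientable⁻ : ∀ {A} → StronglyOrientable G A → Σ (Orientation G) (StronglyOriented (_∈ A))
  strongly-orientable⁻ (o , so) = o , λ u v p → dreach⇒dwalk (so u v (uwalk⇒reach p))

  strongly-orientable⁺ : ∀ {A} → Σ (Orientation G) (StronglyOriented (_∈ A)) → StronglyOrientable G A
  strongly-orientable⁺ (o , so) = o , λ u v r → dwalk⇒dreach (so u v (reach⇒uwalk r))

  Whole : EdgePred
  Whole _ = ⊤

  Cuts : Edge → Edge → Set
  Cuts e f = e ≢ f × ¬ Conn ((Whole - e) - f)

  SameBlock : Edge → Edge → Set
  SameBlock e f = e ≡ f ⊎ Cuts e f

  dec-conn-without : ∀ e f → Dec (Conn ((Whole - e) - f))
  dec-conn-without e f = dec-conn (λ g → (yes tt ×-dec ¬? (g ≟ e)) ×-dec ¬? (g ≟ f))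

  same-block? : ∀ e f → Dec (SameBlock e f)
  same-block? e f = (e ≟ f) ⊎-dec (¬? (e ≟ f) ×-dec ¬? (dec-conn-without e f))

  removed-single⁻ : ∀ {e g} → g ∈ ∁ ⁅ e ⁆ → (Whole - e) g
  removed-single⁻ {e} g∈ = tt , λ { refl → x∈∁p⇒x∉p g∈ (x∈⁅x⁆ e) }

  removed-pair⁻ : ∀ {e f g} → g ∈ ∁ (⁅ e ⁆ ∪ ⁅ f ⁆) → ((Whole - e) - f) g
  removed-pair⁻ {e} {f} g∈ =
    (tt , λ { refl → x∈∁p⇒x∉p g∈ (x∈p∪q⁺ (inj₁ (x∈⁅x⁆ e))) }) ,
    λ { refl → x∈∁p⇒x∉p g∈ (x∈p∪q⁺ (inj₂ (x∈⁅x⁆ f))) }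

  removed-pair⁺ : ∀ {e f g} → ((Whole - e) - f) g → g ∈ ∁ (⁅ e ⁆ ∪ ⁅ f ⁆)
  removed-pair⁺ {e} {f} ((_ , g≢e) , g≢f) = x∉p⇒x∈∁p λ g∈ →
    [ (λ g∈e → g≢e (x∈⁅y⁆⇒x≡y e g∈e)) , (λ g∈f → g≢f (x∈⁅y⁆⇒x≡y f g∈f)) ] (x∈p∪q⁻ _ _ g∈)

  same-block⁻ : ∀ {e f} → e ≡ f ⊎ TwoCut G e f → SameBlock e f
  same-block⁻ (inj₁ e≡f) = inj₁ e≡f
  same-block⁻ (inj₂ (e≢f , disconnected)) =
    inj₂ (e≢f , λ c → disconnected λ u v → uwalk⇒reach (uwalk-mono (λ g → removed-pair⁺) (c u v)))

  same-block⁺ : ∀ {e f} → SameBlock e f → e ≡ f ⊎ TwoCut G e f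
  same-block⁺ (inj₁ e≡f) = inj₁ e≡f
  same-block⁺ (inj₂ (e≢f , disconnected)) =
    inj₂ (e≢f , λ c → disconnected λ u v → uwalk-mono (λ g → removed-pair⁻) (reach⇒uwalk (c u v)))

  two-edge-connected⁻ : TwoEdgeConnected G → ∀ e → Conn (Whole - e)
  two-edge-connected⁻ tec e u v = uwalk-mono (λ g → removed-single⁻) (reach⇒uwalk (tec e u v))

  module TwoEdgeConnectedGraph (tec : ∀ e → Conn (Whole - e)) where
    -- A non-bridge f of a subgraph missing e is a non-bridge of G - e, so
    -- {e, f} does not separate G.
    nonbridge⇒connected : ∀ {P e f} → ¬ P e → NonBridge P f → Conn ((Whole - e) - f)
    nonbridge⇒connected {P} {e} {f} ¬pe nb =
      conn-minus-nonbridge f (tec e) (uwalk-mono (λ g (pg , g≢f) → (tt , λ { refl → ¬pe pg }) , g≢f) nb)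

    orientable-complement⇒connected : ∀ {S e f} → StronglyOrientable G (∁ S) → e ∈ S → f ∉ S →
                                      Conn ((Whole - e) - f)
    orientable-complement⇒connected so e∈S f∉S =
      nonbridge⇒connected (λ e∈∁S → x∈∁p⇒x∉p e∈∁S e∈S)
        (strongly-oriented⇒bridgeless (proj₂ (strongly-orientable⁻ so)) _ (x∉p⇒x∈∁p f∉S))

    cut⇒bridge : ∀ {e f} → Cuts e f → ¬ NonBridge (Whole - e) f
    cut⇒bridge (_ , disconnected) nb = disconnected (conn-minus-nonbridge _ (tec _) nb)

    -- If G - g - f were connected, a
    -- walk between the ends of f shows (as f is a bridge of G - e) that e
    -- is a non-bridge of G - g; rerouting around e then shows that g is a
    -- non-bridge of G - e, which is impossible.
    cuts-trans : ∀ {e g f} → Cuts e g → Cuts e f → g ≢ f → ¬ Conn ((Whole - g) - f)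
    cuts-trans {e} {g} {f} e-g e-f g≢f connected =
      cut⇒bridge e-g (uwalk-mono (λ h ((_ , h≢g) , h≢e) → (tt , h≢e) , h≢g)
        (reroute e e-nonbridge (uwalk-mono (λ h → proj₁) (connected (end₁ g) (end₂ g)))))
      where
      inside : ∀ h → (((Whole - g) - f) - e) h → ((Whole - g) - e) h
      inside h (((_ , h≢g) , _) , h≢e) = (tt , h≢g) , h≢e
      f-inside : ((Whole - g) - e) f
      f-inside = (tt , λ f≡g → g≢f (sym f≡g)) , λ f≡e → proj₁ e-f (sym f≡e)
      e-nonbridge : NonBridge (Whole - g) e
      e-nonbridge with detour e (connected (end₁ f) (end₂ f))
      ... | inj₁ p = ⊥-elim (cut⇒bridge e-f
              (uwalk-mono (λ h (((_ , _) , h≢f) , h≢e) → (tt , h≢e) , h≢f) p))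
      ... | inj₂ (inj₁ (p , q)) = reverse (uwalk-mono inside p)
              ++ step f (f-inside , inj₁ refl) (reverse (uwalk-mono inside q))
      ... | inj₂ (inj₂ (p , q)) = uwalk-mono inside q
              ++ step f (f-inside , inj₂ refl) (uwalk-mono inside p)

    same-block⇒cut : ∀ {e g f} → SameBlock e g → SameBlock e f → g ≢ f → ¬ Conn ((Whole - g) - f)
    same-block⇒cut (inj₁ refl)            (inj₁ refl)            g≢f = ⊥-elim (g≢f refl)
    same-block⇒cut (inj₁ refl)            (inj₂ (_ , disconnected)) _ = disconnected
    same-block⇒cut (inj₂ (_ , disconnected)) (inj₁ refl)            _ = λ c → disconnected λ u v →
      uwalk-mono (λ h ((_ , h≢g) , h≢f) → (tt , h≢f) , h≢g) (c u v)
    same-block⇒cut (inj₂ e-g)             (inj₂ e-f)             g≢f = cuts-trans e-g e-f g≢f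

    -- The edges outside the block of e form a bridgeless subgraph: for such
    -- an f, G - e - f is connected, so f closes a trail of G - e - f into a
    -- cycle; every edge of that cycle is a non-bridge of G - e, hence
    -- outside the block of e.
    outside-block-bridgeless : ∀ e → Bridgeless (λ g → ¬ SameBlock e g)
    outside-block-bridgeless e f ¬e-f =
      reverse (uwalk-mono outside (trail-nonbridges (trailify (connected (end₂ f) (end₁ f)))
                                    (λ h → proj₁) close))
      where
      connected : Conn ((Whole - e) - f)
      connected with dec-conn-without e f
      ... | yes c = c
      ... | no ¬c = ⊥-elim (¬e-f (inj₂ ((λ e≡f → ¬e-f (inj₁ e≡f)) , ¬c)))
      f∈G-e : (Whole - e) f
      f∈G-e = tt , λ f≡e → ¬e-f (inj₁ (sym f≡e))
      close : ∀ h → ((Whole - e) - f) h → UWalk ((Whole - e) - h) (end₁ f) (end₂ f)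
      close h (_ , h≢f) = single ((f∈G-e , λ f≡h → h≢f (sym f≡h)) , inj₁ refl)
      outside : ∀ h → ((Whole - e) - f) h × NonBridge (Whole - e) h → ((λ g → ¬ SameBlock e g) - f) h
      outside h (((_ , h≢e) , h≢f) , nb) =
        (λ { (inj₁ e≡h) → h≢e (sym e≡h) ; (inj₂ e-h) → cut⇒bridge e-h nb }) , h≢f

    block-complement-orientable : ∀ e {S} → (∀ f → f ∈ S → SameBlock e f) →
                                  (∀ f → SameBlock e f → f ∈ S) → StronglyOrientable G (∁ S)
    block-complement-orientable e {S} S⊆block block⊆S =
      strongly-orientable⁺ (robbins bridgeless (λ g → g ∈? ∁ S))
      where
      bridgeless : Bridgeless (_∈ ∁ S)
      bridgeless = bridgeless-cong
        (λ g ¬e-g → x∉p⇒x∈∁p (λ g∈S → ¬e-g (S⊆block g g∈S)))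
        (λ g g∈∁S e-g → x∈∁p⇒x∉p g∈∁S (block⊆S g e-g))
        (outside-block-bridgeless e)

    maximal⇒block : ∀ S → IsMaxProperSO G S → IsTwoCutBlock G S
    maximal⇒block S ((e , e∈S) , so , maximal) =
      e , e∈S , λ f → (λ f∈S → same-block⁺ (S⊆block f f∈S)) , (λ e-f → block⊆S f (same-block⁻ e-f))
      where
      block⊆S : ∀ f → SameBlock e f → f ∈ S
      block⊆S f (inj₁ refl) = e∈S
      block⊆S f (inj₂ (_ , disconnected)) with f ∈? S
      ... | yes f∈S = f∈S
      ... | no  f∉S = ⊥-elim (disconnected (orientable-complement⇒connected so e∈S f∉S))
      block : Subset m
      block = subset-of (same-block? e)
      -- The block of e lies in S; were it smaller, it would contradict maximality.
      S⊆block : ∀ f → f ∈ S → SameBlock e f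
      S⊆block f f∈S with same-block? e f
      ... | yes e-f = e-f
      ... | no ¬e-f = ⊥-elim (maximal block
              ((λ {x} x∈B → block⊆S x (∈-subset-of⁻ _ x∈B)) , f , f∈S , λ f∈B → ¬e-f (∈-subset-of⁻ _ f∈B))
              (e , ∈-subset-of⁺ _ (inj₁ refl))
              (block-complement-orientable e (λ g → ∈-subset-of⁻ _) (λ g → ∈-subset-of⁺ _)))

    block⇒maximal : ∀ S → IsTwoCutBlock G S → IsMaxProperSO G S
    block⇒maximal S (e , e∈S , members) =
      (e , e∈S) , block-complement-orientable e S⊆block block⊆S , maximal
      where
      S⊆block : ∀ f → f ∈ S → SameBlock e f
      S⊆block f f∈S = same-block⁻ (proj₁ (members f) f∈S)
      block⊆S : ∀ f → SameBlock e f → f ∈ S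
      block⊆S f e-f = proj₂ (members f) (same-block⁺ e-f)
      -- If G - S' were strongly orientable, with g ∈ S' and f ∈ S outside S',
      -- then G - g - f would be connected, although g ≠ f lie in one block.
      maximal : ∀ S' → S' ⊂ S → Nonempty S' → ¬ StronglyOrientable G (∁ S')
      maximal S' (S'⊆S , f , f∈S , f∉S') (g , g∈S') so' =
        same-block⇒cut (S⊆block g (S'⊆S g∈S')) (S⊆block f f∈S) (λ { refl → f∉S' g∈S' })
          (orientable-complement⇒connected so' g∈S' f∉S')

lemma3p10 : (G : Graph) → Connected G → TwoEdgeConnected G →
    (S : Subset (Graph.m G)) →
    (IsMaxProperSO G S → IsTwoCutBlock G S) × (IsTwoCutBlock G S → IsMaxProperSO G S)
lemma3p10 G _ two-edge-connected S = maximal⇒block S , block⇒maximal S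
  where
  open Theory G
  open TwoEdgeConnectedGraph (two-edge-connected⁻ two-edge-connected)
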